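{- Let $n$ be a positive integer represented by the form $x^2+2y^2+4z^2$. Then there exist $(x_1,y_1,z_1),(x_2,y_2,z_2)\in\mathbb{Z}^3$ with $z_1$ odd and $z_2$ even such that $n=x_1^2+2y_1^2+4z_1^2=x_2^2+2y_2^2+4z_2^2$ if and only if $n\equiv 4\pmod 8$, or $n\equiv 6\pmod{16}$, or $n\equiv 8$ or $16\pmod{32}$. -}

module Defs where

open import Data.Integer using (ℤ; _+_; _*_; +_)

form : ℤ → ℤ → ℤ → ℤ
form x y z = x * x + (+ 2) * (y * y) + (+ 4) * (z * z)

-- Modulo 32, form x y z depends only on x mod 16, y mod 8 and z mod 4, so every congruence fact
-- needed is a finite check over these residues.  Forward: the residues of n mod 32 attained with
-- z odd and those attained with z even meet exactly in the four stated classes.  Backward, for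
-- n ≡ 4 (mod 8) or n ≡ 6 (mod 16): every representation has x + 2z ≡ 2 (mod 4), i.e. x = 2a with
-- a + z odd, and form (2a) y z = form (2z) y a exchanges the parity of the last coordinate.  For
-- n ≡ 8, 16 (mod 32): x + 2z ≡ 0 (mod 4) and y = 2b, so x = 2(u + v), z = u - v and
-- n = 8(u² + v² + b²); conversely form (2(p + q)) (2r) (p - q) = 8(p² + q² + r²) for every
-- ordering (p, q, r) of (u, v, b).  As n / 8 ≡ 1, 2 (mod 4), u, v, b are not all of one parity,
-- so p - q can be made odd or even at will.

module Submission where

open import Defs
open import Data.Nat using (ℕ; _%_; _>_)
open import Data.Integer using (ℤ; +_)
open import Data.Integer.Divisibility using (_∣_)
open import Data.Product using (Σ; _×_; ∃; ∃-syntax)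
open import Data.Sum using (_⊎_)
open import Relation.Binary.PropositionalEquality using (_≡_)
open import Relation.Nullary using (¬_)
open import Function.Bundles using (_⇔_)

open import Data.Empty using (⊥-elim)
open import Data.Fin using (Fin; zero; suc; toℕ; fromℕ<)
open import Data.Fin.Properties using (all?; any?; toℕ-fromℕ<)
open import Data.Integer using (_+_; _*_; _-_; -_; -[1+_]; _/ℕ_)
import Data.Integer as ℤ
open import Data.Integer.DivMod using (n%ℕd<d; a≡a%ℕn+[a/ℕn]*n)
open import Data.Integer.Properties using (+-injective; pos-+; pos-*)
import Data.Integer.Divisibility.Signed as Signed
open import Data.Integer.Tactic.RingSolver using (solve-∀; solve)
open import Data.List using (_∷_; [])
import Data.Nat as ℕ
import Data.Nat.DivMod as ℕ
import Data.Nat.Divisibility as ℕ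
open import Data.Product using (_,_; ∃₂; proj₁; proj₂; uncurry)
open import Data.Sum using (inj₁; inj₂; assocˡ; assocʳ)
open import Function.Base using (_∘_)
open import Function.Bundles using (mk⇔; module Equivalence)
open import Relation.Binary.PropositionalEquality
  using (refl; sym; trans; cong; cong₂; subst; module ≡-Reasoning)
open import Relation.Nullary using (Dec; ¬?)
open import Relation.Nullary.Decidable using (toWitness; _×-dec_; _⊎-dec_; _→-dec_)

open Equivalence using (to; from)
open ≡-Reasoning

divMod : ∀ m .{{_ : ℕ.NonZero m}} x → ∃₂ λ (r : Fin m) q → x ≡ + toℕ r + q * + m
divMod m x = fromℕ< (n%ℕd<d x m) , x /ℕ m ,
  trans (a≡a%ℕn+[a/ℕn]*n x m) (cong (λ r → + r + x /ℕ m * + m) (sym (toℕ-fromℕ< _)))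

n≡r+q*m⇒n%m≡r%m : ∀ m .{{_ : ℕ.NonZero m}} {n r} q → + n ≡ + r + q * + m → n % m ≡ r % m
n≡r+q*m⇒n%m≡r%m m {n} {r} (+ k) eq = begin
  n % m               ≡⟨ cong (_% m) (+-injective (trans eq (sym +[r+km]))) ⟩
  (r ℕ.+ k ℕ.* m) % m ≡⟨ ℕ.[m+kn]%n≡m%n r k m ⟩
  r % m               ∎
  where
  +[r+km] : + (r ℕ.+ k ℕ.* m) ≡ + r + + k * + m
  +[r+km] = trans (pos-+ r (k ℕ.* m)) (cong (_+_ (+ r)) (pos-* k m))
n≡r+q*m⇒n%m≡r%m m {n} {r} -[1+ k ] eq = sym (n≡r+q*m⇒n%m≡r%m m (+ ℕ.suc k) (begin
  + r                                     ≡⟨ cancel (+ r) -[1+ k ] (+ m) ⟩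
  + r + -[1+ k ] * + m + + ℕ.suc k * + m  ≡⟨ cong (_+ + ℕ.suc k * + m) (sym eq) ⟩
  + n + + ℕ.suc k * + m                   ∎))
  where
  cancel : ∀ a q b → a ≡ a + q * b + (- q) * b
  cancel = solve-∀

-- The indices have the shape produced by divMod 2, so matching on the view needs no rewriting.
data Parity : ℤ → Set where
  even : ∀ a → Parity (+ 0 + a * + 2)
  odd  : ∀ a → Parity (+ 1 + a * + 2)

parity : ∀ x → Parity x
parity x with divMod 2 x
... | zero , a , refl = even a
... | suc zero , a , refl = odd a

infix 4 _∣?_
_∣?_ : ∀ d z → Dec (d ∣ z)
d ∣? z = ℤ.∣ d ∣ ℕ.∣? ℤ.∣ z ∣

∣m+k*n⇔∣m : ∀ d m k n → d ∣ n → (d ∣ m + k * n) ⇔ (d ∣ m)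
∣m+k*n⇔∣m d m k n d∣n = mk⇔
  (λ d∣m+kn → Signed.∣⇒∣ᵤ {d} {m} (Signed.∣m+n∣n⇒∣m (Signed.∣ᵤ⇒∣ {d} {m + k * n} d∣m+kn) d∣kn))
  (λ d∣m → Signed.∣⇒∣ᵤ {d} {m + k * n} (Signed.∣m∣n⇒∣m+n (Signed.∣ᵤ⇒∣ {d} {m} d∣m) d∣kn))
  where
  d∣kn : d Signed.∣ k * n
  d∣kn = Signed.∣n⇒∣m*n k (Signed.∣ᵤ⇒∣ {d} {n} d∣n)

2∣even : ∀ a → + 2 ∣ + 0 + a * + 2
2∣even a = from (∣m+k*n⇔∣m (+ 2) (+ 0) a (+ 2) (ℕ.divides 1 refl)) (ℕ.divides 0 refl)

2∤odd : ∀ a → ¬ (+ 2 ∣ + 1 + a * + 2)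
2∤odd a 2∣ with ℕ.∣1⇒≡1 (to (∣m+k*n⇔∣m (+ 2) (+ 1) a (+ 2) (ℕ.divides 1 refl)) 2∣)
... | ()

OppositeParity : ℤ → ℤ → Set
OppositeParity a b = (+ 2 ∣ a) × ¬ (+ 2 ∣ b) ⊎ ¬ (+ 2 ∣ a) × (+ 2 ∣ b)

e+c*2+b≡1+s*2⇒b≡1-e+[s-c]*2 : ∀ e c b s → e + c * + 2 + b ≡ + 1 + s * + 2 → b ≡ + 1 - e + (s - c) * + 2
e+c*2+b≡1+s*2⇒b≡1-e+[s-c]*2 e c b s eq = begin
  b                                ≡⟨ solve (b ∷ e ∷ c ∷ []) ⟩
  e + c * + 2 + b - (e + c * + 2)  ≡⟨ cong (_- (e + c * + 2)) eq ⟩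
  + 1 + s * + 2 - (e + c * + 2)    ≡⟨ solve (s ∷ e ∷ c ∷ []) ⟩
  + 1 - e + (s - c) * + 2          ∎

odd-sum⇒opposite-parity : ∀ a b s → a + b ≡ + 1 + s * + 2 → OppositeParity a b
odd-sum⇒opposite-parity a b s a+b≡ with parity a
... | even c = inj₁ (2∣even c ,
  subst (¬_ ∘ (+ 2 ∣_)) (sym (e+c*2+b≡1+s*2⇒b≡1-e+[s-c]*2 (+ 0) c b s a+b≡)) (2∤odd (s - c)))
... | odd c = inj₂ (2∤odd c ,
  subst (+ 2 ∣_) (sym (e+c*2+b≡1+s*2⇒b≡1-e+[s-c]*2 (+ 1) c b s a+b≡)) (2∣even (s - c)))

2∣same-parity : ∀ e a b → + 2 ∣ (e + a * + 2) - (e + b * + 2)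
2∣same-parity e a b = subst (+ 2 ∣_) (sym difference) (2∣even (a - b))
  where
  difference : (e + a * + 2) - (e + b * + 2) ≡ + 0 + (a - b) * + 2
  difference = solve (e ∷ a ∷ b ∷ [])

2∤odd-even : ∀ a b → ¬ (+ 2 ∣ (+ 1 + a * + 2) - (+ 0 + b * + 2))
2∤odd-even a b = subst (¬_ ∘ (+ 2 ∣_)) (sym difference) (2∤odd (a - b))
  where
  difference : (+ 1 + a * + 2) - (+ 0 + b * + 2) ≡ + 1 + (a - b) * + 2
  difference = solve (a ∷ b ∷ [])

2∤even-odd : ∀ a b → ¬ (+ 2 ∣ (+ 0 + a * + 2) - (+ 1 + b * + 2))
2∤even-odd a b = subst (¬_ ∘ (+ 2 ∣_)) (sym difference) (2∤odd (a - b - + 1))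
  where
  difference : (+ 0 + a * + 2) - (+ 1 + b * + 2) ≡ + 1 + (a - b - + 1) * + 2
  difference = solve (a ∷ b ∷ [])

ℕ-form : ℕ → ℕ → ℕ → ℕ
ℕ-form i j k = i ℕ.* i ℕ.+ 2 ℕ.* (j ℕ.* j) ℕ.+ 4 ℕ.* (k ℕ.* k)

form-+ : ∀ i j k → form (+ i) (+ j) (+ k) ≡ + ℕ-form i j k
form-+ i j k = sym (begin
  + ℕ-form i j k
    ≡⟨ pos-+ (i ℕ.* i ℕ.+ 2 ℕ.* (j ℕ.* j)) (4 ℕ.* (k ℕ.* k)) ⟩
  + (i ℕ.* i ℕ.+ 2 ℕ.* (j ℕ.* j)) + + (4 ℕ.* (k ℕ.* k))
    ≡⟨ cong (_+ + (4 ℕ.* (k ℕ.* k))) (pos-+ (i ℕ.* i) (2 ℕ.* (j ℕ.* j))) ⟩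
  + (i ℕ.* i) + + (2 ℕ.* (j ℕ.* j)) + + (4 ℕ.* (k ℕ.* k))
    ≡⟨ cong₂ _+_ (cong₂ _+_ (pos-* i i) (pos-c*sq 2 j)) (pos-c*sq 4 k) ⟩
  form (+ i) (+ j) (+ k) ∎)
  where
  pos-c*sq : ∀ c a → + (c ℕ.* (a ℕ.* a)) ≡ + c * (+ a * + a)
  pos-c*sq c a = trans (pos-* c (a ℕ.* a)) (cong (+ c *_) (pos-* a a))

form-carry : ℤ → ℤ → ℤ → ℤ → ℤ → ℤ → ℤ
form-carry a b c q₁ q₂ q₃ = a * q₁ + + 8 * (q₁ * q₁) + b * q₂ + + 4 * (q₂ * q₂) + c * q₃ + + 2 * (q₃ * q₃)

form-shift : ∀ a b c q₁ q₂ q₃ →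
  form (a + q₁ * + 16) (b + q₂ * + 8) (c + q₃ * + 4) ≡ form a b c + form-carry a b c q₁ q₂ q₃ * + 32
form-shift a b c q₁ q₂ q₃ = begin
  (a + q₁ * + 16) * (a + q₁ * + 16) + + 2 * ((b + q₂ * + 8) * (b + q₂ * + 8))
    + + 4 * ((c + q₃ * + 4) * (c + q₃ * + 4))
      ≡⟨ solve (a ∷ b ∷ c ∷ q₁ ∷ q₂ ∷ q₃ ∷ []) ⟩
  a * a + + 2 * (b * b) + + 4 * (c * c)
    + (a * q₁ + + 8 * (q₁ * q₁) + b * q₂ + + 4 * (q₂ * q₂) + c * q₃ + + 2 * (q₃ * q₃)) * + 32 ∎

data Residues (n : ℕ) : ℤ → ℤ → ℤ → Set where
  residues : ∀ (i : Fin 16) (j : Fin 8) (k : Fin 4) q₁ q₂ q₃ →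
    n % 32 ≡ ℕ-form (toℕ i) (toℕ j) (toℕ k) % 32 →
    Residues n (+ toℕ i + q₁ * + 16) (+ toℕ j + q₂ * + 8) (+ toℕ k + q₃ * + 4)

residues-of : ∀ {x y z n} → form x y z ≡ + n → Residues n x y z
residues-of {x} {y} {z} {n} e with divMod 16 x | divMod 8 y | divMod 4 z
... | i , q₁ , refl | j , q₂ , refl | k , q₃ , refl =
  residues i j k q₁ q₂ q₃ (n≡r+q*m⇒n%m≡r%m 32 carry (begin
    + n                                                 ≡⟨ sym e ⟩
    form (a + q₁ * + 16) (b + q₂ * + 8) (c + q₃ * + 4)  ≡⟨ form-shift a b c q₁ q₂ q₃ ⟩
    form a b c + carry * + 32                           ≡⟨ cong (_+ carry * + 32) (form-+ (toℕ i) (toℕ j) (toℕ k)) ⟩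
    + ℕ-form (toℕ i) (toℕ j) (toℕ k) + carry * + 32     ∎))
  where
  a b c carry : ℤ
  a = + toℕ i
  b = + toℕ j
  c = + toℕ k
  carry = form-carry a b c q₁ q₂ q₃

ClassAB ClassCD ResidueCondition : ℕ → Set
ClassAB n = n % 8 ≡ 4 ⊎ n % 16 ≡ 6
ClassCD n = n % 32 ≡ 8 ⊎ n % 32 ≡ 16
ResidueCondition n = ClassAB n ⊎ ClassCD n

%≡%⇒%≡% : ∀ d m .{{_ : ℕ.NonZero d}} .{{_ : ℕ.NonZero m}} {a b} → d ℕ.∣ m → a % m ≡ b % m → a % d ≡ b % d
%≡%⇒%≡% d m {a} {b} d∣m eq = begin
  a % d     ≡⟨ ℕ.m∣n⇒o%n%m≡o%m d m a d∣m ⟨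
  a % m % d ≡⟨ cong (_% d) eq ⟩
  b % m % d ≡⟨ ℕ.m∣n⇒o%n%m≡o%m d m b d∣m ⟩
  b % d     ∎

classAB-resp : ∀ {a b} → a % 32 ≡ b % 32 → ClassAB a → ClassAB b
classAB-resp {a} {b} eq (inj₁ a%8) = inj₁ (trans (sym (%≡%⇒%≡% 8 32 {a} {b} (ℕ.divides 4 refl) eq)) a%8)
classAB-resp {a} {b} eq (inj₂ a%16) = inj₂ (trans (sym (%≡%⇒%≡% 16 32 {a} {b} (ℕ.divides 2 refl) eq)) a%16)

classCD-resp : ∀ {a b} → a % 32 ≡ b % 32 → ClassCD a → ClassCD b
classCD-resp eq (inj₁ a%32) = inj₁ (trans (sym eq) a%32)
classCD-resp eq (inj₂ a%32) = inj₂ (trans (sym eq) a%32)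

residueCondition-resp : ∀ {a b} → a % 32 ≡ b % 32 → ResidueCondition a → ResidueCondition b
residueCondition-resp {a} {b} eq (inj₁ AB) = inj₁ (classAB-resp {a} {b} eq AB)
residueCondition-resp {a} {b} eq (inj₂ CD) = inj₂ (classCD-resp {a} {b} eq CD)

classAB? : ∀ n → Dec (ClassAB n)
classAB? n = (n % 8 ℕ.≟ 4) ⊎-dec (n % 16 ℕ.≟ 6)

classCD? : ∀ n → Dec (ClassCD n)
classCD? n = (n % 32 ℕ.≟ 8) ⊎-dec (n % 32 ℕ.≟ 16)

residueCondition? : ∀ n → Dec (ResidueCondition n)
residueCondition? n = classAB? n ⊎-dec classCD? n

FormResidue : (ℤ → Set) → ℕ → Set
FormResidue P r = ∃[ i ] ∃[ j ] ∃[ k ] P (+ toℕ {4} k) × ℕ-form (toℕ {16} i) (toℕ {8} j) (toℕ k) % 32 ≡ r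

formResidue? : ∀ {P} → (∀ z → Dec (P z)) → ∀ r → Dec (FormResidue P r)
formResidue? P? r = any? λ i → any? λ j → any? λ k →
  P? (+ toℕ k) ×-dec (ℕ-form (toℕ i) (toℕ j) (toℕ k) % 32 ℕ.≟ r)

odd-even-overlap : ∀ (r : Fin 32) →
  FormResidue (λ z → ¬ (+ 2 ∣ z)) (toℕ r) → FormResidue (+ 2 ∣_) (toℕ r) → ResidueCondition (toℕ r)
odd-even-overlap = toWitness {a? = all? λ r →
  formResidue? (¬? ∘ (+ 2 ∣?_)) (toℕ r) →-dec formResidue? (+ 2 ∣?_) (toℕ r) →-dec
  residueCondition? (toℕ r)} _

classAB-residues : ∀ (i : Fin 16) (j : Fin 8) (k : Fin 4) →
  ClassAB (ℕ-form (toℕ i) (toℕ j) (toℕ k)) → + 4 ∣ + toℕ i + + 2 * + toℕ k + + 2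
classAB-residues = toWitness {a? = all? λ i → all? λ j → all? λ k →
  classAB? (ℕ-form (toℕ i) (toℕ j) (toℕ k)) →-dec (+ 4 ∣? + toℕ i + + 2 * + toℕ k + + 2)} _

classCD-residues : ∀ (i : Fin 16) (j : Fin 8) (k : Fin 4) →
  ClassCD (ℕ-form (toℕ i) (toℕ j) (toℕ k)) → (+ 4 ∣ + toℕ i + + 2 * + toℕ k) × (+ 2 ∣ + toℕ j)
classCD-residues = toWitness {a? = all? λ i → all? λ j → all? λ k →
  classCD? (ℕ-form (toℕ i) (toℕ j) (toℕ k)) →-dec (+ 4 ∣? + toℕ i + + 2 * + toℕ k) ×-dec (+ 2 ∣? + toℕ j)} _

form≡⇒formResidue : ∀ {P : ℤ → Set} {x y z n} → (∀ a q → P (a + q * + 4) → P a) →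
  form x y z ≡ + n → P z → FormResidue P (n % 32)
form≡⇒formResidue {x = x} {y} {z} P-residue e Pz with residues-of {x} {y} {z} e
... | residues i j k q₁ q₂ q₃ n≡ = i , j , k , P-residue (+ toℕ k) q₃ Pz , sym n≡

classAB⇒4∣x+2z+2 : ∀ {x y z n} → form x y z ≡ + n → ClassAB n → + 4 ∣ x + + 2 * z + + 2
classAB⇒4∣x+2z+2 {x} {y} {z} {n} e AB with residues-of {x} {y} {z} e
... | residues i j k q₁ q₂ q₃ n≡ = subst (+ 4 ∣_) (sym (regroup a c q₁ q₃))
  (from (∣m+k*n⇔∣m (+ 4) (a + + 2 * c + + 2) (+ 4 * q₁ + + 2 * q₃) (+ 4) (ℕ.divides 1 refl))
    (classAB-residues i j k (classAB-resp {n} {ℕ-form (toℕ i) (toℕ j) (toℕ k)} n≡ AB)))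
  where
  a c : ℤ
  a = + toℕ i
  c = + toℕ k
  regroup : ∀ a c q₁ q₃ →
    a + q₁ * + 16 + + 2 * (c + q₃ * + 4) + + 2 ≡ a + + 2 * c + + 2 + (+ 4 * q₁ + + 2 * q₃) * + 4
  regroup = solve-∀

classCD⇒4∣x+2z×2∣y : ∀ {x y z n} → form x y z ≡ + n → ClassCD n → (+ 4 ∣ x + + 2 * z) × (+ 2 ∣ y)
classCD⇒4∣x+2z×2∣y {x} {y} {z} {n} e CD with residues-of {x} {y} {z} e
... | residues i j k q₁ q₂ q₃ n≡ =
  subst (+ 4 ∣_) (sym (regroup a c q₁ q₃))
    (from (∣m+k*n⇔∣m (+ 4) (a + + 2 * c) (+ 4 * q₁ + + 2 * q₃) (+ 4) (ℕ.divides 1 refl)) (proj₁ digits)) ,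
  from (∣m+k*n⇔∣m (+ 2) b q₂ (+ 8) (ℕ.divides 4 refl)) (proj₂ digits)
  where
  a b c : ℤ
  a = + toℕ i
  b = + toℕ j
  c = + toℕ k
  digits : (+ 4 ∣ a + + 2 * c) × (+ 2 ∣ b)
  digits = classCD-residues i j k (classCD-resp {n} {ℕ-form (toℕ i) (toℕ j) (toℕ k)} n≡ CD)
  regroup : ∀ a c q₁ q₃ → a + q₁ * + 16 + + 2 * (c + q₃ * + 4) ≡ a + + 2 * c + (+ 4 * q₁ + + 2 * q₃) * + 4
  regroup = solve-∀

BothParities : ℕ → Set
BothParities n = ∃[ x₁ ] ∃[ y₁ ] ∃[ z₁ ] ∃[ x₂ ] ∃[ y₂ ] ∃[ z₂ ]
  (¬ (+ 2 ∣ z₁)) × (+ 2 ∣ z₂) × form x₁ y₁ z₁ ≡ + n × form x₂ y₂ z₂ ≡ + n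

bothParities⇒residueCondition : ∀ {n} → BothParities n → ResidueCondition n
bothParities⇒residueCondition {n} (x₁ , y₁ , z₁ , x₂ , y₂ , z₂ , 2∤z₁ , 2∣z₂ , e₁ , e₂) =
  residueCondition-resp {toℕ r} {n} (trans (cong (_% 32) toℕ-r) (ℕ.m%n%n≡m%n n 32))
    (odd-even-overlap r
      (subst (FormResidue Odd) (sym toℕ-r) (form≡⇒formResidue {Odd} {x₁} {y₁} {z₁} odd-residue e₁ 2∤z₁))
      (subst (FormResidue Even) (sym toℕ-r) (form≡⇒formResidue {Even} {x₂} {y₂} {z₂} even-residue e₂ 2∣z₂)))
  where
  Odd Even : ℤ → Set
  Odd z = ¬ (+ 2 ∣ z)
  Even z = + 2 ∣ z
  odd-residue : ∀ a q → Odd (a + q * + 4) → Odd a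
  odd-residue a q 2∤a+4q = 2∤a+4q ∘ from (∣m+k*n⇔∣m (+ 2) a q (+ 4) (ℕ.divides 2 refl))
  even-residue : ∀ a q → Even (a + q * + 4) → Even a
  even-residue a q = to (∣m+k*n⇔∣m (+ 2) a q (+ 4) (ℕ.divides 2 refl))
  r : Fin 32
  r = n ℕ.mod 32
  toℕ-r : toℕ r ≡ n % 32
  toℕ-r = toℕ-fromℕ< (ℕ.m%n<n n 32)

form-swap : ∀ a y z → form (+ 2 * a) y z ≡ form (+ 2 * z) y a
form-swap a y z = begin
  (+ 2 * a) * (+ 2 * a) + + 2 * (y * y) + + 4 * (z * z)  ≡⟨ solve (a ∷ y ∷ z ∷ []) ⟩
  (+ 2 * z) * (+ 2 * z) + + 2 * (y * y) + + 4 * (a * a)  ∎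

swap-rep : ∀ {x y z n} a → form x y z ≡ + n → x ≡ + 2 * a → form (+ 2 * z) y a ≡ + n
swap-rep {x} {y} {z} {n} a e x≡2a = begin
  form (+ 2 * z) y a  ≡⟨ form-swap a y z ⟨
  form (+ 2 * a) y z  ≡⟨ cong (λ w → form w y z) x≡2a ⟨
  form x y z          ≡⟨ e ⟩
  + n                 ∎

swap⇒bothParities : ∀ {x y z n} a → form x y z ≡ + n → x ≡ + 2 * a → OppositeParity z a → BothParities n
swap⇒bothParities {x} {y} {z} a e x≡2a (inj₁ (2∣z , 2∤a)) =
  + 2 * z , y , a , x , y , z , 2∤a , 2∣z , swap-rep {x} {y} {z} a e x≡2a , e
swap⇒bothParities {x} {y} {z} a e x≡2a (inj₂ (2∤z , 2∣a)) =
  x , y , z , + 2 * z , y , a , 2∤z , 2∣a , e , swap-rep {x} {y} {z} a e x≡2a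

4∣x+2z+2⇒bothParities : ∀ {x y z n} → form x y z ≡ + n → + 4 ∣ x + + 2 * z + + 2 → BothParities n
4∣x+2z+2⇒bothParities {x} {y} {z} e 4∣x+2z+2 with Signed.∣ᵤ⇒∣ {+ 4} {x + + 2 * z + + 2} 4∣x+2z+2
... | Signed.divides t eq = swap⇒bothParities {x} {y} {z} (+ 2 * t - z - + 1) e x≡2a
  (odd-sum⇒opposite-parity z (+ 2 * t - z - + 1) (t - + 1) (solve (z ∷ t ∷ [])))
  where
  x≡2a : x ≡ + 2 * (+ 2 * t - z - + 1)
  x≡2a = begin
    x                                   ≡⟨ solve (x ∷ z ∷ []) ⟩
    x + + 2 * z + + 2 - + 2 * z - + 2   ≡⟨ cong (λ w → w - + 2 * z - + 2) eq ⟩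
    t * + 4 - + 2 * z - + 2             ≡⟨ solve (t ∷ z ∷ []) ⟩
    + 2 * (+ 2 * t - z - + 1)           ∎

sumSq : ℤ → ℤ → ℤ → ℤ
sumSq p q r = p * p + q * q + r * r

sumSq-swap : ∀ p q r → sumSq p q r ≡ sumSq p r q
sumSq-swap p q r = begin
  p * p + q * q + r * r  ≡⟨ solve (p ∷ q ∷ r ∷ []) ⟩
  p * p + r * r + q * q  ∎

sumSq-rotate : ∀ p q r → sumSq p q r ≡ sumSq q r p
sumSq-rotate p q r = begin
  p * p + q * q + r * r  ≡⟨ solve (p ∷ q ∷ r ∷ []) ⟩
  q * q + r * r + p * p  ∎

form-sumSq : ∀ p q r → form (+ 2 * (p + q)) (+ 2 * r) (p - q) ≡ + 8 * sumSq p q r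
form-sumSq p q r = begin
  (+ 2 * (p + q)) * (+ 2 * (p + q)) + + 2 * ((+ 2 * r) * (+ 2 * r)) + + 4 * ((p - q) * (p - q))
    ≡⟨ solve (p ∷ q ∷ r ∷ []) ⟩
  + 8 * (p * p + q * q + r * r) ∎

same-parity-sumSq : ∀ e a b c → + 8 * sumSq (e + a * + 2) (e + b * + 2) (e + c * + 2) ≡
  + 24 * (e * e) + (sumSq a b c + e * (a + b + c)) * + 32
same-parity-sumSq e a b c = begin
  + 8 * ((e + a * + 2) * (e + a * + 2) + (e + b * + 2) * (e + b * + 2) + (e + c * + 2) * (e + c * + 2))
    ≡⟨ solve (e ∷ a ∷ b ∷ c ∷ []) ⟩
  + 24 * (e * e) + (a * a + b * b + c * c + e * (a + b + c)) * + 32 ∎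

same-parity⇒¬classCD : ∀ {n} (ε : Fin 2) a b c →
  + n ≡ + 8 * sumSq (+ toℕ ε + a * + 2) (+ toℕ ε + b * + 2) (+ toℕ ε + c * + 2) → ¬ ClassCD n
same-parity⇒¬classCD {n} zero a b c e CD
  with classCD-resp {n} {0}
    (n≡r+q*m⇒n%m≡r%m 32 (sumSq a b c + + 0 * (a + b + c)) (trans e (same-parity-sumSq (+ 0) a b c))) CD
... | inj₁ ()
... | inj₂ ()
same-parity⇒¬classCD {n} (suc zero) a b c e CD
  with classCD-resp {n} {24}
    (n≡r+q*m⇒n%m≡r%m 32 (sumSq a b c + + 1 * (a + b + c)) (trans e (same-parity-sumSq (+ 1) a b c))) CD
... | inj₁ ()
... | inj₂ ()

arrangement⇒bothParities : ∀ {n} s t w → + n ≡ + 8 * sumSq s t w → + 2 ∣ s - t → ¬ (+ 2 ∣ s - w) →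
  BothParities n
arrangement⇒bothParities s t w e 2∣s-t 2∤s-w =
  + 2 * (s + w) , + 2 * t , s - w , + 2 * (s + t) , + 2 * w , s - t , 2∤s-w , 2∣s-t ,
  trans (form-sumSq s w t) (trans (cong (+ 8 *_) (sumSq-swap s w t)) (sym e)) ,
  trans (form-sumSq s t w) (sym e)

sumSq⇒bothParities : ∀ {n} p q r → + n ≡ + 8 * sumSq p q r → ClassCD n → BothParities n
sumSq⇒bothParities p q r e CD with parity p | parity q | parity r
... | even a | even b | even c = ⊥-elim (same-parity⇒¬classCD zero a b c e CD)
... | odd a  | odd b  | odd c  = ⊥-elim (same-parity⇒¬classCD (suc zero) a b c e CD)
... | even a | even b | odd c  = arrangement⇒bothParities p q r e (2∣same-parity (+ 0) a b) (2∤even-odd a c)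
... | odd a  | odd b  | even c = arrangement⇒bothParities p q r e (2∣same-parity (+ 1) a b) (2∤odd-even a c)
... | even a | odd b  | even c = arrangement⇒bothParities p r q (trans e (cong (+ 8 *_) (sumSq-swap p q r)))
  (2∣same-parity (+ 0) a c) (2∤even-odd a b)
... | odd a  | even b | odd c  = arrangement⇒bothParities p r q (trans e (cong (+ 8 *_) (sumSq-swap p q r)))
  (2∣same-parity (+ 1) a c) (2∤odd-even a b)
... | odd a  | even b | even c = arrangement⇒bothParities q r p (trans e (cong (+ 8 *_) (sumSq-rotate p q r)))
  (2∣same-parity (+ 0) b c) (2∤even-odd b a)
... | even a | odd b  | odd c  = arrangement⇒bothParities q r p (trans e (cong (+ 8 *_) (sumSq-rotate p q r)))
  (2∣same-parity (+ 1) b c) (2∤odd-even b a)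

4∣x+2z⇒bothParities : ∀ {x y z n} → form x y z ≡ + n → ClassCD n → + 4 ∣ x + + 2 * z → + 2 ∣ y →
  BothParities n
4∣x+2z⇒bothParities {x} {y} {z} {n} e CD 4∣x+2z 2∣y
  with Signed.∣ᵤ⇒∣ {+ 4} {x + + 2 * z} 4∣x+2z | Signed.∣ᵤ⇒∣ {+ 2} {y} 2∣y
... | Signed.divides t eq | Signed.divides b refl = sumSq⇒bothParities t (t - z) b (begin
  + n                                   ≡⟨ sym e ⟩
  form x (b * + 2) z                    ≡⟨ cong (λ w → form w (b * + 2) z) x≡ ⟩
  form (t * + 4 - + 2 * z) (b * + 2) z  ≡⟨ as-sumSq ⟩
  + 8 * sumSq t (t - z) b               ∎) CD
  where
  x≡ : x ≡ t * + 4 - + 2 * z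
  x≡ = begin
    x                        ≡⟨ solve (x ∷ z ∷ []) ⟩
    x + + 2 * z - + 2 * z    ≡⟨ cong (_- + 2 * z) eq ⟩
    t * + 4 - + 2 * z        ∎
  as-sumSq : form (t * + 4 - + 2 * z) (b * + 2) z ≡ + 8 * sumSq t (t - z) b
  as-sumSq = begin
    (t * + 4 - + 2 * z) * (t * + 4 - + 2 * z) + + 2 * ((b * + 2) * (b * + 2)) + + 4 * (z * z)
      ≡⟨ solve (t ∷ z ∷ b ∷ []) ⟩
    + 8 * (t * t + (t - z) * (t - z) + b * b) ∎

residueCondition⇒bothParities : ∀ {x y z n} → form x y z ≡ + n → ResidueCondition n → BothParities n
residueCondition⇒bothParities {x} {y} {z} e (inj₁ AB) =
  4∣x+2z+2⇒bothParities {x} {y} {z} e (classAB⇒4∣x+2z+2 {x} {y} {z} e AB)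
residueCondition⇒bothParities {x} {y} {z} e (inj₂ CD) =
  uncurry (4∣x+2z⇒bothParities {x} {y} {z} e CD) (classCD⇒4∣x+2z×2∣y {x} {y} {z} e CD)

lemma3p5 : (n : ℕ) → n > 0 → (∃[ x ] ∃[ y ] ∃[ z ] form x y z ≡ + n) →
    ((∃[ x₁ ] ∃[ y₁ ] ∃[ z₁ ] ∃[ x₂ ] ∃[ y₂ ] ∃[ z₂ ]
        (¬ (+ 2 ∣ z₁)) × (+ 2 ∣ z₂) × form x₁ y₁ z₁ ≡ + n × form x₂ y₂ z₂ ≡ + n)
     ⇔ (n % 8 ≡ 4 ⊎ n % 16 ≡ 6 ⊎ n % 32 ≡ 8 ⊎ n % 32 ≡ 16))
lemma3p5 n _ (x , y , z , e) =
  mk⇔ (assocʳ ∘ bothParities⇒residueCondition) (residueCondition⇒bothParities {x} {y} {z} e ∘ assocˡ)
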